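{- Let $\pi\in S_n$ correspond to the pair $(P,Q)$ of standard Young tableaux of common shape $\lambda$ under the Robinson–Schensted correspondence. Then $$\mathrm{sgn}(\pi)=(-1)^{v(\lambda)}\,\mathrm{sgn}(P)\,\mathrm{sgn}(Q).$$
   Context: A standard Young tableau (SYT) on an $n$-shape (Ferrers diagram of a partition of $n$) is a filling with $1,\ldots,n$, each once, increasing along rows and down columns. The sign of a tableau is the sign of the word obtained by reading its entries row by row, left to right, top to bottom; the sign of a word (or permutation in one-line notation) of distinct integers is $(-1)^{\#\text{inversions}}$. $v(\lambda)$ is the maximal number of disjoint vertical dominoes ($2\times1$ rectangles) that fit in $\lambda$. In the Robinson–Schensted correspondence, $P$ is the insertion tableau obtained by row-inserting $\pi_1,\ldots,\pi_n$ successively, and $Q$ is the recording tableau. -}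

module Defs where

open import Data.Nat using (ℕ; zero; suc; _<_; _≤_; _+_; _<ᵇ_)
open import Data.Bool using (Bool; true; false; if_then_else_)
open import Data.List using (List; []; _∷_; _++_; map; length; concat)
open import Data.List.Relation.Unary.All using (All)
open import Data.List.Relation.Unary.AllPairs using (AllPairs)
open import Data.Product using (_×_; _,_; proj₁; proj₂; Σ)
open import Data.Sum using (_⊎_)
open import Data.Integer using (ℤ; -1ℤ; _^_)
open import Relation.Binary.PropositionalEquality using (_≡_)
open import Relation.Nullary using (¬_)

-- Tableaux are lists of rows (top row first), each row a list of
-- entries read left to right.

Tableau : Set
Tableau = List (List ℕ)

shape : Tableau → List ℕ
shape = map length

readingWord : Tableau → List ℕ
readingWord = concat

countLess : ℕ → List ℕ → ℕ
countLess x [] = 0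
countLess x (y ∷ ys) = (if y <ᵇ x then 1 else 0) + countLess x ys

inversions : List ℕ → ℕ
inversions [] = 0
inversions (x ∷ xs) = countLess x xs + inversions xs

sgn : List ℕ → ℤ
sgn w = -1ℤ ^ inversions w

data Bump : Set where
  appended : Bump
  bumped   : ℕ → Bump

insertRow : ℕ → List ℕ → List ℕ × Bump
insertRow x [] = (x ∷ [] , appended)
insertRow x (y ∷ ys) with x <ᵇ y
... | true  = (x ∷ ys , bumped y)
... | false with insertRow x ys
...   | (ys' , b) = (y ∷ ys' , b)

-- row-insert x into a tableau; returns the new tableau and the index of
-- the row in which the new cell was created
insertTab : ℕ → Tableau → Tableau × ℕ
insertTab x [] = ((x ∷ []) ∷ [] , 0)
insertTab x (r ∷ rs) with insertRow x r
... | (r' , appended) = (r' ∷ rs , 0)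
... | (r' , bumped y) with insertTab y rs
...   | (rs' , i) = (r' ∷ rs' , suc i)

addAt : ℕ → ℕ → Tableau → Tableau
addAt k zero [] = (k ∷ []) ∷ []
addAt k zero (r ∷ rs) = (r ++ (k ∷ [])) ∷ rs
addAt k (suc i) [] = (k ∷ []) ∷ []
addAt k (suc i) (r ∷ rs) = r ∷ addAt k i rs

-- process the letters, the j-th letter (1-based: j = step) recorded as j
rsFrom : ℕ → List ℕ → Tableau × Tableau → Tableau × Tableau
rsFrom step [] PQ = PQ
rsFrom step (x ∷ xs) (P , Q) with insertTab x P
... | (P' , i) = rsFrom (suc step) xs (P' , addAt step i Q)

RS : List ℕ → Tableau × Tableau
RS π = rsFrom 1 π ([] , [])

rowLen : List ℕ → ℕ → ℕ
rowLen [] i = 0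
rowLen (l ∷ ls) zero = l
rowLen (l ∷ ls) (suc i) = rowLen ls i

-- cell (i , j) (row i, column j, 0-based) lies in λ
InShape : List ℕ → ℕ × ℕ → Set
InShape λs (i , j) = j < rowLen λs i

-- a vertical domino is given by its top cell (i , j); it occupies
-- (i , j) and (i+1 , j)
FitsDomino : List ℕ → ℕ × ℕ → Set
FitsDomino λs (i , j) = InShape λs (i , j) × InShape λs (suc i , j)

Overlap : ℕ × ℕ → ℕ × ℕ → Set
Overlap (i , j) (i' , j') = j ≡ j' × (i ≡ i' ⊎ (suc i ≡ i' ⊎ i ≡ suc i'))

DominoFamily : List ℕ → List (ℕ × ℕ) → Set
DominoFamily λs ds = All (FitsDomino λs) ds × AllPairs (λ d e → ¬ Overlap d e) ds

IsV : List ℕ → ℕ → Set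
IsV λs m =
  Σ (List (ℕ × ℕ)) (λ ds → DominoFamily λs ds × length ds ≡ m)
  × (∀ ds → DominoFamily λs ds → length ds ≤ m)

-- Run the insertion letter by letter and track inversion counts modulo 2.  When x is row-inserted
-- into P and the new cell appears at the end of row i (rows counted from 0), the reading word of
-- the new P arises from the reading word of P followed by x through i transpositions, one per
-- bump (the bumping entry trades places with the entry it bumps), and a final move of the last
-- bumped entry leftwards past the b cells below row i.  In Q the new, maximal entry is placed in
-- front of those same b cells, creating exactly b inversions, and λ₂ + λ₄ + ⋯ changes parity by i.
-- So sgn w = (-1)^(λ₂ + λ₄ + ⋯) sgn P sgn Q is preserved.  Finally v(λ) = λ₂ + λ₄ + ⋯ for a
-- partition λ: dominoes stacked on the rows λ₂, λ₄, … attain this number, and every vertical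
-- domino covers exactly one cell of an even-numbered row.

module Submission where

open import Defs
open import Data.Nat using (ℕ; suc)
open import Data.List using (List; map; upTo)
open import Data.Product using (proj₁; proj₂)
open import Data.Integer using (ℤ; -1ℤ; _^_; _*_)
open import Data.List.Relation.Binary.Permutation.Propositional using (_↭_)
open import Relation.Binary.PropositionalEquality using (_≡_)

open import Data.Bool using (true; false; if_then_else_)
open import Data.Empty using (⊥-elim)
open import Data.Integer using (1ℤ)
import Data.Integer.Properties as ℤ
open import Data.List using ([]; _∷_; _++_; _∷ʳ_; [_]; length; drop)
open import Data.List.Properties
  using (++-assoc; ++-identityʳ; length-++; length-map; length-upTo; map-cong; length-removeAt′)
open import Data.List.Membership.Propositional using (_∈_; _∉_)
open import Data.List.Membership.Propositional.Properties using (∈-++⁺ˡ; ∈-++⁺ʳ; ∈-map⁺; ∈-upTo⁺)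
open import Data.List.Relation.Unary.All as All using (All; []; _∷_)
import Data.List.Relation.Unary.All.Properties as All
open import Data.List.Relation.Unary.AllPairs as AllPairs using ([]; _∷_)
import Data.List.Relation.Unary.AllPairs.Properties as AllPairs
open import Data.List.Relation.Unary.Any using (here; there; _─_)
open import Data.List.Relation.Unary.Linked as Linked using (Linked; []; [-]; _∷_)
open import Data.List.Relation.Unary.Unique.Propositional using (Unique)
open import Data.List.Relation.Unary.Unique.Propositional.Properties using (Unique[x∷xs]⇒x∉xs)
import Data.List.Relation.Unary.Unique.Propositional.Properties as Unique
open import Data.List.Relation.Binary.Permutation.Propositional
  using (↭-refl; ↭-reflexive; ↭-sym; ↭-trans; ↭⇒↭ₛ; prep; swap)
open import Data.List.Relation.Binary.Permutation.Propositional.Properties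
  using (All-resp-↭; map⁺; shift; ++⁺ˡ; ++⁺ʳ; ∷↭∷ʳ)
open import Data.List.Relation.Binary.Prefix.Heterogeneous using (Prefix; []; _∷_)
open import Data.List.Relation.Binary.Prefix.Heterogeneous.Properties using (length-mono)
open import Data.Maybe using (Maybe; just; nothing)
open import Data.Nat as ℕ using (zero; _+_; _<_; _>_; _≤_; _≥_; _<ᵇ_; z≤n; s≤s; parity)
open import Data.Nat.ListAction using (sum)
open import Data.Nat.ListAction.Properties using (sum-↭)
open import Data.Nat.Properties
  using (+-assoc; +-comm; +-suc; +-identityʳ; suc-injective; <-trans; <-asym; <⇒≢; <-≤-trans;
         ≤-antisym; ≮⇒≥; ≤∧≢⇒<; n<1+n; m<n⇒m<1+n; <ᵇ-reflects-<; +-commutativeSemigroup)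
open import Algebra.Properties.CommutativeSemigroup +-commutativeSemigroup using (interchange)
open import Data.Nat.Tactic.RingSolver using (solve-∀)
open import Data.Parity.Base using (Parity; 0ℙ; 1ℙ) renaming (_+_ to _⊕_)
import Data.Parity.Properties as ℙ
open import Data.Product using (_×_; _,_; Σ; ∃₂; map₁)
open import Data.Sum using (inj₁; inj₂) renaming (map to ⊎-map)
open import Data.Unit using (⊤; tt)
open import Function using (_∘_)
open import Level using (0ℓ)
open import Relation.Binary.PropositionalEquality
  using (refl; sym; trans; cong; cong₂; subst; subst₂; _≢_; setoid; module ≡-Reasoning)
open import Data.List.Relation.Binary.Permutation.Setoid.Properties (setoid ℕ) using (Unique-resp-↭)
open import Relation.Nullary.Negation using (¬_)
open import Relation.Nullary.Reflects using (ofʸ; ofⁿ)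
import Tactic.RingSolver as RingSolver
open import Tactic.RingSolver.Core.AlmostCommutativeRing
  using (AlmostCommutativeRing; fromCommutativeRing)

open ≡-Reasoning

-- Parity is ℤ/2ℤ, so the ring solver also cancels doubled terms.
parityRing : AlmostCommutativeRing 0ℓ 0ℓ
parityRing = fromCommutativeRing ℙ.+-*-commutativeRing isZero
  where
  isZero : ∀ p → Maybe (0ℙ ≡ p)
  isZero 0ℙ = just refl
  isZero 1ℙ = nothing

paritySign : Parity → ℤ
paritySign 0ℙ = 1ℤ
paritySign 1ℙ = -1ℤ

paritySign-⊕ : ∀ p q → paritySign (p ⊕ q) ≡ paritySign p * paritySign q
paritySign-⊕ 0ℙ 0ℙ = refl
paritySign-⊕ 0ℙ 1ℙ = refl
paritySign-⊕ 1ℙ 0ℙ = refl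
paritySign-⊕ 1ℙ 1ℙ = refl

-1^≡paritySign : ∀ n → -1ℤ ^ n ≡ paritySign (parity n)
-1^≡paritySign zero = refl
-1^≡paritySign (suc zero) = refl
-1^≡paritySign (suc (suc n)) = begin
  -1ℤ * (-1ℤ * -1ℤ ^ n)  ≡⟨ sym (ℤ.*-assoc -1ℤ -1ℤ (-1ℤ ^ n)) ⟩
  1ℤ * -1ℤ ^ n           ≡⟨ ℤ.*-identityˡ (-1ℤ ^ n) ⟩
  -1ℤ ^ n                ≡⟨ -1^≡paritySign n ⟩
  paritySign (parity n)  ∎

parity-+≡+2* : ∀ a b c d → a + b ≡ c + 2 ℕ.* d → parity a ≡ parity b ⊕ parity c
parity-+≡+2* a b c d eq = begin
  parity a                                ≡⟨ add-twice (parity a) (parity b) ⟩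
  parity a ⊕ parity b ⊕ parity b          ≡⟨ cong (_⊕ parity b) (sym (ℙ.+-homo-+ a b)) ⟩
  parity (a + b) ⊕ parity b               ≡⟨ cong (λ n → parity n ⊕ parity b) eq ⟩
  parity (c + 2 ℕ.* d) ⊕ parity b         ≡⟨ cong (_⊕ parity b) (ℙ.+-homo-+ c (2 ℕ.* d)) ⟩
  parity c ⊕ parity (2 ℕ.* d) ⊕ parity b
    ≡⟨ cong (λ p → parity c ⊕ p ⊕ parity b) (ℙ.*-homo-* 2 d) ⟩
  parity c ⊕ 0ℙ ⊕ parity b                ≡⟨ cong (_⊕ parity b) (ℙ.+-identityʳ (parity c)) ⟩
  parity c ⊕ parity b                     ≡⟨ ℙ.+-comm (parity c) (parity b) ⟩
  parity b ⊕ parity c                     ∎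
  where
  add-twice : ∀ p q → p ≡ p ⊕ q ⊕ q
  add-twice = RingSolver.solve-∀ parityRing

countGreater : ℕ → List ℕ → ℕ
countGreater x [] = 0
countGreater x (y ∷ ys) = (if x <ᵇ y then 1 else 0) + countGreater x ys

crossInversions : List ℕ → List ℕ → ℕ
crossInversions u v = sum (map (λ a → countLess a v) u)

countLess-++ : ∀ x u v → countLess x (u ++ v) ≡ countLess x u + countLess x v
countLess-++ x [] v = refl
countLess-++ x (y ∷ u) v =
  trans (cong (_ +_) (countLess-++ x u v)) (sym (+-assoc (if y <ᵇ x then 1 else 0) _ _))

countLess-↭ : ∀ x {u v} → u ↭ v → countLess x u ≡ countLess x v
countLess-↭ x {u} {v} p = trans (asSum u) (trans (sum-↭ (map⁺ isLess p)) (sym (asSum v)))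
  where
  isLess : ℕ → ℕ
  isLess y = if y <ᵇ x then 1 else 0
  asSum : ∀ w → countLess x w ≡ sum (map isLess w)
  asSum [] = refl
  asSum (y ∷ w) = cong (isLess y +_) (asSum w)

countLess+countGreater≡length : ∀ {x} w → x ∉ w → countLess x w + countGreater x w ≡ length w
countLess+countGreater≡length [] _ = refl
countLess+countGreater≡length {x} (y ∷ w) x∉
  with y <ᵇ x | <ᵇ-reflects-< y x | x <ᵇ y | <ᵇ-reflects-< x y
     | countLess+countGreater≡length w (x∉ ∘ there)
... | true  | ofʸ y<x | true  | ofʸ x<y | _  = ⊥-elim (<-asym y<x x<y)
... | true  | _       | false | _       | ih = cong suc ih
... | false | _       | true  | _       | ih = trans (+-suc _ _) (cong suc ih)
... | false | ofⁿ y≮x | false | ofⁿ x≮y | _  =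
  ⊥-elim (x∉ (here (≤-antisym (≮⇒≥ y≮x) (≮⇒≥ x≮y))))

countLess-all< : ∀ {k} v → All (_< k) v → countLess k v ≡ length v
countLess-all< [] [] = refl
countLess-all< {k} (a ∷ v) (a<k ∷ v<k) with a <ᵇ k | <ᵇ-reflects-< a k
... | true  | _       = cong suc (countLess-all< v v<k)
... | false | ofⁿ a≮k = ⊥-elim (a≮k a<k)

countGreater-all< : ∀ {k} u → All (_< k) u → countGreater k u ≡ 0
countGreater-all< [] [] = refl
countGreater-all< {k} (a ∷ u) (a<k ∷ u<k) with k <ᵇ a | <ᵇ-reflects-< k a
... | true  | ofʸ k<a = ⊥-elim (<-asym a<k k<a)
... | false | _       = countGreater-all< u u<k

crossInversions-↭ˡ : ∀ {u u′} v → u ↭ u′ → crossInversions u v ≡ crossInversions u′ v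
crossInversions-↭ˡ v p = sum-↭ (map⁺ (λ a → countLess a v) p)

crossInversions-↭ʳ : ∀ u {v v′} → v ↭ v′ → crossInversions u v ≡ crossInversions u v′
crossInversions-↭ʳ u p = cong sum (map-cong (λ a → countLess-↭ a p) u)

crossInversions-∷ : ∀ u x v → crossInversions u (x ∷ v) ≡ countGreater x u + crossInversions u v
crossInversions-∷ [] x v = refl
crossInversions-∷ (a ∷ u) x v =
  trans (cong (countLess a (x ∷ v) +_) (crossInversions-∷ u x v))
        (interchange (if x <ᵇ a then 1 else 0) (countLess a v) _ _)

crossInversions-[] : ∀ u → crossInversions u [] ≡ 0
crossInversions-[] [] = refl
crossInversions-[] (a ∷ u) = crossInversions-[] u

inversions-++ : ∀ u v → inversions (u ++ v) ≡ inversions u + inversions v + crossInversions u v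
inversions-++ [] v = sym (+-identityʳ (inversions v))
inversions-++ (a ∷ u) v =
  trans (cong₂ _+_ (countLess-++ a u v) (inversions-++ u v))
        (regroup (countLess a u) (countLess a v) (inversions u) (inversions v) (crossInversions u v))
  where
  regroup : ∀ p q r s t → p + q + (r + s + t) ≡ p + r + s + (q + t)
  regroup = solve-∀

inversions-∷ʳ : ∀ w x → inversions (w ∷ʳ x) ≡ inversions w + countGreater x w
inversions-∷ʳ w x = begin
  inversions (w ++ [ x ])
    ≡⟨ inversions-++ w [ x ] ⟩
  inversions w + 0 + crossInversions w [ x ]
    ≡⟨ cong₂ _+_ (+-identityʳ (inversions w)) (crossInversions-∷ w x []) ⟩
  inversions w + (countGreater x w + crossInversions w [])
    ≡⟨ cong (λ n → inversions w + (countGreater x w + n)) (crossInversions-[] w) ⟩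
  inversions w + (countGreater x w + 0)
    ≡⟨ cong (inversions w +_) (+-identityʳ (countGreater x w)) ⟩
  inversions w + countGreater x w ∎

inversions-rotate : ∀ {x} v → x ∉ v →
  inversions (x ∷ v) + inversions (v ∷ʳ x) ≡ length v + 2 ℕ.* inversions v
inversions-rotate {x} v x∉v = begin
  countLess x v + inversions v + inversions (v ∷ʳ x)
    ≡⟨ cong (countLess x v + inversions v +_) (inversions-∷ʳ v x) ⟩
  countLess x v + inversions v + (inversions v + countGreater x v)
    ≡⟨ regroup (countLess x v) (countGreater x v) (inversions v) ⟩
  countLess x v + countGreater x v + 2 ℕ.* inversions v
    ≡⟨ cong (_+ 2 ℕ.* inversions v) (countLess+countGreater≡length v x∉v) ⟩
  length v + 2 ℕ.* inversions v ∎
  where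
  regroup : ∀ l g i → l + i + (i + g) ≡ l + g + 2 ℕ.* i
  regroup = solve-∀

inversions-transpose : ∀ {x y} m → x ≢ y → x ∉ m → y ∉ m →
  inversions (x ∷ (m ∷ʳ y)) + inversions (y ∷ (m ∷ʳ x)) ≡ 1 + 2 ℕ.* (length m + inversions m)
inversions-transpose {x} {y} m x≢y x∉m y∉m = begin
  countLess x (m ∷ʳ y) + inversions (m ∷ʳ y) + (countLess y (m ∷ʳ x) + inversions (m ∷ʳ x))
    ≡⟨ cong₂ _+_ (cong₂ _+_ (countLess-++ x m [ y ]) (inversions-∷ʳ m y))
                 (cong₂ _+_ (countLess-++ y m [ x ]) (inversions-∷ʳ m x)) ⟩
  lx + countLess x [ y ] + (i + gy) + (ly + countGreater x [ y ] + (i + gx))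
    ≡⟨ regroup lx gx ly gy (countLess x [ y ]) (countGreater x [ y ]) i ⟩
  lx + gx + (ly + gy) + (countLess x [ y ] + countGreater x [ y ]) + 2 ℕ.* i
    ≡⟨ cong₂ (λ a b → a + b + _ + 2 ℕ.* i) (countLess+countGreater≡length m x∉m)
                                           (countLess+countGreater≡length m y∉m) ⟩
  length m + length m + (countLess x [ y ] + countGreater x [ y ]) + 2 ℕ.* i
    ≡⟨ cong (λ n → length m + length m + n + 2 ℕ.* i) (countLess+countGreater≡length [ y ] x∉[y]) ⟩
  length m + length m + 1 + 2 ℕ.* i
    ≡⟨ collect (length m) i ⟩
  1 + 2 ℕ.* (length m + i) ∎
  where
  lx = countLess x m
  ly = countLess y m
  gx = countGreater x m
  gy = countGreater y m
  i = inversions m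
  x∉[y] : x ∉ [ y ]
  x∉[y] (here x≡y) = x≢y x≡y
  regroup : ∀ lx gx ly gy c c′ i →
    lx + c + (i + gy) + (ly + c′ + (i + gx)) ≡ lx + gx + (ly + gy) + (c + c′) + 2 ℕ.* i
  regroup = solve-∀
  collect : ∀ l i → l + l + 1 + 2 ℕ.* i ≡ 1 + 2 ℕ.* (l + i)
  collect = solve-∀

inversions-insertMax : ∀ {k} u v → All (_< k) (u ++ v) →
  inversions (u ++ k ∷ v) ≡ inversions (u ++ v) + length v
inversions-insertMax {k} u v u++v<k = begin
  inversions (u ++ k ∷ v)
    ≡⟨ inversions-++ u (k ∷ v) ⟩
  inversions u + (countLess k v + inversions v) + crossInversions u (k ∷ v)
    ≡⟨ cong₂ (λ l c → inversions u + (l + inversions v) + c)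
             (countLess-all< v (All.++⁻ʳ u u++v<k)) (crossInversions-∷ u k v) ⟩
  inversions u + (length v + inversions v) + (countGreater k u + crossInversions u v)
    ≡⟨ cong (λ g → inversions u + (length v + inversions v) + (g + crossInversions u v))
            (countGreater-all< u (All.++⁻ˡ u u++v<k)) ⟩
  inversions u + (length v + inversions v) + crossInversions u v
    ≡⟨ regroup (inversions u) (length v) (inversions v) (crossInversions u v) ⟩
  inversions u + inversions v + crossInversions u v + length v
    ≡⟨ cong (_+ length v) (sym (inversions-++ u v)) ⟩
  inversions (u ++ v) + length v ∎
  where
  regroup : ∀ a l b c → a + (l + b) + c ≡ a + b + c + l
  regroup = solve-∀

wordParity : List ℕ → Parity
wordParity w = parity (inversions w)

wordParity-++ : ∀ u v →
  wordParity (u ++ v) ≡ wordParity u ⊕ wordParity v ⊕ parity (crossInversions u v)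
wordParity-++ u v = begin
  parity (inversions (u ++ v))
    ≡⟨ cong parity (inversions-++ u v) ⟩
  parity (inversions u + inversions v + crossInversions u v)
    ≡⟨ ℙ.+-homo-+ (inversions u + inversions v) (crossInversions u v) ⟩
  parity (inversions u + inversions v) ⊕ parity (crossInversions u v)
    ≡⟨ cong (_⊕ parity (crossInversions u v)) (ℙ.+-homo-+ (inversions u) (inversions v)) ⟩
  wordParity u ⊕ wordParity v ⊕ parity (crossInversions u v) ∎

wordParity-++ˡ : ∀ {u u′} v {δ} → u ↭ u′ → wordParity u ≡ wordParity u′ ⊕ δ →
  wordParity (u ++ v) ≡ wordParity (u′ ++ v) ⊕ δ
wordParity-++ˡ {u} {u′} v {δ} p eq = begin
  wordParity (u ++ v)
    ≡⟨ wordParity-++ u v ⟩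
  wordParity u ⊕ wordParity v ⊕ parity (crossInversions u v)
    ≡⟨ cong₂ (λ a c → a ⊕ wordParity v ⊕ parity c) eq (crossInversions-↭ˡ v p) ⟩
  wordParity u′ ⊕ δ ⊕ wordParity v ⊕ parity (crossInversions u′ v)
    ≡⟨ regroup (wordParity u′) δ (wordParity v) (parity (crossInversions u′ v)) ⟩
  wordParity u′ ⊕ wordParity v ⊕ parity (crossInversions u′ v) ⊕ δ
    ≡⟨ cong (_⊕ δ) (sym (wordParity-++ u′ v)) ⟩
  wordParity (u′ ++ v) ⊕ δ ∎
  where
  regroup : ∀ a d b c → a ⊕ d ⊕ b ⊕ c ≡ a ⊕ b ⊕ c ⊕ d
  regroup = RingSolver.solve-∀ parityRing

wordParity-++ʳ : ∀ u {v v′ δ} → v ↭ v′ → wordParity v ≡ wordParity v′ ⊕ δ →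
  wordParity (u ++ v) ≡ wordParity (u ++ v′) ⊕ δ
wordParity-++ʳ u {v} {v′} {δ} p eq = begin
  wordParity (u ++ v)
    ≡⟨ wordParity-++ u v ⟩
  wordParity u ⊕ wordParity v ⊕ parity (crossInversions u v)
    ≡⟨ cong₂ (λ b c → wordParity u ⊕ b ⊕ parity c) eq (crossInversions-↭ʳ u p) ⟩
  wordParity u ⊕ (wordParity v′ ⊕ δ) ⊕ parity (crossInversions u v′)
    ≡⟨ regroup (wordParity u) (wordParity v′) δ (parity (crossInversions u v′)) ⟩
  wordParity u ⊕ wordParity v′ ⊕ parity (crossInversions u v′) ⊕ δ
    ≡⟨ cong (_⊕ δ) (sym (wordParity-++ u v′)) ⟩
  wordParity (u ++ v′) ⊕ δ ∎
  where
  regroup : ∀ a b d c → a ⊕ (b ⊕ d) ⊕ c ≡ a ⊕ b ⊕ c ⊕ d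
  regroup = RingSolver.solve-∀ parityRing

wordParity-rotate : ∀ {x} v → x ∉ v → wordParity (x ∷ v) ≡ wordParity (v ∷ʳ x) ⊕ parity (length v)
wordParity-rotate {x} v x∉v =
  parity-+≡+2* (inversions (x ∷ v)) (inversions (v ∷ʳ x)) (length v) (inversions v)
    (inversions-rotate v x∉v)

wordParity-transpose : ∀ {x y} m → x ≢ y → x ∉ m → y ∉ m →
  wordParity (x ∷ (m ∷ʳ y)) ≡ wordParity (y ∷ (m ∷ʳ x)) ⊕ 1ℙ
wordParity-transpose {x} {y} m x≢y x∉m y∉m =
  parity-+≡+2* (inversions (x ∷ (m ∷ʳ y))) (inversions (y ∷ (m ∷ʳ x))) 1 (length m + inversions m)
    (inversions-transpose m x≢y x∉m y∉m)

-- The two words differ by exchanging the entries x and y.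
wordParity-bump : ∀ u v W {x y} → x ≢ y → x ∉ v ++ W → y ∉ v ++ W →
  wordParity ((u ++ x ∷ v) ++ (W ∷ʳ y)) ≡ wordParity (((u ++ y ∷ v) ++ W) ∷ʳ x) ⊕ 1ℙ
wordParity-bump u v W {x} {y} x≢y x∉ y∉ = begin
  wordParity ((u ++ x ∷ v) ++ (W ∷ʳ y))
    ≡⟨ cong wordParity (regroup x y) ⟩
  wordParity (u ++ x ∷ ((v ++ W) ∷ʳ y))
    ≡⟨ wordParity-++ʳ u (swap-ends x y (v ++ W)) (wordParity-transpose (v ++ W) x≢y x∉ y∉) ⟩
  wordParity (u ++ y ∷ ((v ++ W) ∷ʳ x)) ⊕ 1ℙ
    ≡⟨ cong (λ w → wordParity w ⊕ 1ℙ) (sym (trans (++-assoc (u ++ y ∷ v) W [ x ]) (regroup y x))) ⟩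
  wordParity (((u ++ y ∷ v) ++ W) ∷ʳ x) ⊕ 1ℙ ∎
  where
  regroup : ∀ a b → (u ++ a ∷ v) ++ (W ∷ʳ b) ≡ u ++ a ∷ ((v ++ W) ∷ʳ b)
  regroup a b = trans (++-assoc u (a ∷ v) (W ∷ʳ b)) (cong (λ z → u ++ a ∷ z) (sym (++-assoc v W [ b ])))
  swap-ends : ∀ a b m → a ∷ (m ∷ʳ b) ↭ b ∷ (m ∷ʳ a)
  swap-ends a b m =
    ↭-trans (prep a (↭-sym (∷↭∷ʳ b m))) (↭-trans (swap a b ↭-refl) (prep b (∷↭∷ʳ a m)))

addCell : ℕ → List ℕ → List ℕ
addCell zero [] = 1 ∷ []
addCell zero (l ∷ ls) = suc l ∷ ls
addCell (suc i) [] = 1 ∷ []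
addCell (suc i) (l ∷ ls) = l ∷ addCell i ls

cellsBelow : ℕ → List ℕ → ℕ
cellsBelow i ls = sum (drop (suc i) ls)

-- λ₂ + λ₄ + ⋯ in the paper's 1-based numbering of rows.
oddRows : List ℕ → ℕ
oddRows (_ ∷ l ∷ ls) = l + oddRows ls
oddRows _ = 0

length-readingWord : ∀ T → length (readingWord T) ≡ sum (shape T)
length-readingWord [] = refl
length-readingWord (r ∷ rs) = trans (length-++ r) (cong (length r +_) (length-readingWord rs))

oddRows-addCell : ∀ i ls → i ≤ length ls →
  parity (oddRows (addCell i ls)) ≡ parity (oddRows ls) ⊕ parity i
oddRows-addCell zero [] _ = refl
oddRows-addCell zero (_ ∷ []) _ = refl
oddRows-addCell zero (_ ∷ l ∷ ls) _ = sym (ℙ.+-identityʳ (parity (l + oddRows ls)))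
oddRows-addCell (suc zero) (_ ∷ []) _ = refl
oddRows-addCell (suc zero) (_ ∷ l ∷ ls) _ =
  trans (ℙ.+-homo-+ 1 (l + oddRows ls)) (ℙ.+-comm 1ℙ (parity (l + oddRows ls)))
oddRows-addCell (suc (suc i)) (_ ∷ l ∷ ls) (s≤s (s≤s i≤)) = begin
  parity (l + oddRows (addCell i ls))          ≡⟨ ℙ.+-homo-+ l (oddRows (addCell i ls)) ⟩
  parity l ⊕ parity (oddRows (addCell i ls))   ≡⟨ cong (parity l ⊕_) (oddRows-addCell i ls i≤) ⟩
  parity l ⊕ (parity (oddRows ls) ⊕ parity i)  ≡⟨ sym (ℙ.+-assoc (parity l) _ (parity i)) ⟩
  parity l ⊕ parity (oddRows ls) ⊕ parity i    ≡⟨ cong (_⊕ parity i) (sym (ℙ.+-homo-+ l (oddRows ls))) ⟩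
  parity (l + oddRows ls) ⊕ parity i           ∎

Unique-++⁻ʳ : ∀ {A : Set} (u : List A) {v} → Unique (u ++ v) → Unique v
Unique-++⁻ʳ [] uniq = uniq
Unique-++⁻ʳ (_ ∷ u) (_ ∷ uniq) = Unique-++⁻ʳ u uniq

Unique-++⁻ˡ : ∀ {A : Set} (u : List A) {v} → Unique (u ++ v) → Unique u
Unique-++⁻ˡ [] _ = []
Unique-++⁻ˡ (_ ∷ u) (fresh ∷ uniq) = All.++⁻ˡ u fresh ∷ Unique-++⁻ˡ u uniq

Unique-↭ : ∀ {xs ys : List ℕ} → xs ↭ ys → Unique xs → Unique ys
Unique-↭ p = Unique-resp-↭ (↭⇒↭ₛ p)

Unique-∷-prefix : ∀ w {x : ℕ} {xs} → Unique (w ++ x ∷ xs) → Unique (x ∷ w)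
Unique-∷-prefix w {x} {xs} uniq = Unique-++⁻ˡ (x ∷ w) (Unique-↭ (shift x w xs) uniq)

Unique-bump : ∀ u {x y : ℕ} {v W} → Unique (x ∷ (u ++ y ∷ v) ++ W) →
  x ∉ v ++ W × y ∉ v ++ W × Unique (y ∷ W)
Unique-bump u {x} {y} {v} {W} (x-fresh ∷ uniq)
  with y-fresh ∷ uniq′ ← Unique-++⁻ʳ u (subst Unique (++-assoc u (y ∷ v) W) uniq) =
  All.All¬⇒¬Any (All.tail (All.++⁻ʳ u (subst (All (x ≢_)) (++-assoc u (y ∷ v) W) x-fresh))) ,
  All.All¬⇒¬Any y-fresh ,
  All.++⁻ʳ v y-fresh ∷ Unique-++⁻ʳ v uniq′

-- The graph of insertRow on rows not containing x.
data RowInsertion (x : ℕ) : List ℕ → List ℕ × Bump → Set where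
  append   : RowInsertion x [] ([ x ] , appended)
  bumpHere : ∀ {y v} → x < y → RowInsertion x (y ∷ v) (x ∷ v , bumped y)
  skip     : ∀ {c r r′ b} → c < x → RowInsertion x r (r′ , b) → RowInsertion x (c ∷ r) (c ∷ r′ , b)

insertRow-view : ∀ {x} r → x ∉ r → RowInsertion x r (insertRow x r)
insertRow-view [] _ = append
insertRow-view {x} (c ∷ r) x∉ with x <ᵇ c | <ᵇ-reflects-< x c
... | true  | ofʸ x<c = bumpHere x<c
... | false | ofⁿ x≮c with insertRow x r | insertRow-view r (x∉ ∘ there)
...   | _ | ri = skip (≤∧≢⇒< (≮⇒≥ x≮c) (λ c≡x → x∉ (here (sym c≡x)))) ri

RowInsertion-appended : ∀ {x r r′} → RowInsertion x r (r′ , appended) → r′ ≡ r ∷ʳ x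
RowInsertion-appended append = refl
RowInsertion-appended (skip _ ri) = cong (_ ∷_) (RowInsertion-appended ri)

RowInsertion-bumped : ∀ {x r r′ y} → RowInsertion x r (r′ , bumped y) →
  x < y × ∃₂ λ u v → r ≡ u ++ y ∷ v × r′ ≡ u ++ x ∷ v
RowInsertion-bumped (bumpHere x<y) = x<y , [] , _ , refl , refl
RowInsertion-bumped (skip {c} _ ri) with RowInsertion-bumped ri
... | x<y , u , v , refl , refl = x<y , c ∷ u , v , refl , refl

RowInsertion-↭ : ∀ {x r r′ y} → RowInsertion x r (r′ , bumped y) → y ∷ r′ ↭ x ∷ r
RowInsertion-↭ (bumpHere _) = swap _ _ ↭-refl
RowInsertion-↭ {x} {y = y} (skip {c} _ ri) =
  ↭-trans (swap y c ↭-refl) (↭-trans (prep c (RowInsertion-↭ ri)) (swap c x ↭-refl))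

RowInsertion-unique : ∀ {x r r′ y W} → RowInsertion x r (r′ , bumped y) →
  Unique (x ∷ r ++ W) → Unique (y ∷ W)
RowInsertion-unique ri uniq with RowInsertion-bumped ri
... | _ , u , _ , refl , _ = proj₂ (proj₂ (Unique-bump u uniq))

Below : List ℕ → List ℕ → Set
Below s r = Prefix _>_ s r

firstRow : Tableau → List ℕ
firstRow [] = []
firstRow (r ∷ _) = r

ColumnStrict : Tableau → Set
ColumnStrict [] = ⊤
ColumnStrict (r ∷ rs) = Below (firstRow rs) r × ColumnStrict rs

columnStrict⇒shape-decreasing : ∀ T → ColumnStrict T → Linked _≥_ (shape T)
columnStrict⇒shape-decreasing [] _ = []
columnStrict⇒shape-decreasing (r ∷ []) _ = [-]
columnStrict⇒shape-decreasing (r ∷ s ∷ rs) (s-below-r , cs) =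
  length-mono s-below-r ∷ columnStrict⇒shape-decreasing (s ∷ rs) cs

Below-insert : ∀ {x s r r′ b} → Below s r → RowInsertion x r (r′ , b) → Below s r′
Below-insert [] _ = []
Below-insert (c<b ∷ below) (bumpHere x<c) = <-trans x<c c<b ∷ below
Below-insert (c<b ∷ below) (skip _ ri) = c<b ∷ Below-insert below ri

Below-bump : ∀ {x y r r′ s s′ b} → RowInsertion x r (r′ , bumped y) → Below s r →
  RowInsertion y s (s′ , b) → Below s′ r′
Below-bump (bumpHere x<y) [] append = x<y ∷ []
Below-bump (bumpHere x<y) (_ ∷ below) (bumpHere _) = x<y ∷ below
Below-bump (bumpHere _) (y<b ∷ _) (skip b<y _) = ⊥-elim (<-asym y<b b<y)
Below-bump (skip c<x ri) [] append = <-trans c<x (proj₁ (RowInsertion-bumped ri)) ∷ []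
Below-bump (skip c<x ri) (_ ∷ below) (bumpHere _) =
  <-trans c<x (proj₁ (RowInsertion-bumped ri)) ∷ Below-insert below ri
Below-bump (skip _ ri) (c<b ∷ below) (skip _ si) = c<b ∷ Below-bump ri below si

-- The graph of insertTab on tableaux not containing x.
data TabInsertion (x : ℕ) : Tableau → Tableau × ℕ → Set where
  newRow : TabInsertion x [] ([ x ] ∷ [] , 0)
  settle : ∀ {r r′ rs} → RowInsertion x r (r′ , appended) → TabInsertion x (r ∷ rs) (r′ ∷ rs , 0)
  bump   : ∀ {r r′ y rs rs′ i} → RowInsertion x r (r′ , bumped y) → TabInsertion y rs (rs′ , i) →
           TabInsertion x (r ∷ rs) (r′ ∷ rs′ , suc i)

insertTab-view : ∀ {x} T → Unique (x ∷ readingWord T) → TabInsertion x T (insertTab x T)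
insertTab-view [] _ = newRow
insertTab-view {x} (r ∷ rs) uniq
  with insertRow x r | insertRow-view r (Unique[x∷xs]⇒x∉xs uniq ∘ ∈-++⁺ˡ)
... | (_ , appended) | ri = settle ri
... | (_ , bumped y) | ri with insertTab y rs | insertTab-view rs (RowInsertion-unique ri uniq)
...   | _ | t = bump ri t

TabInsertion-index : ∀ {x T P′ i} → TabInsertion x T (P′ , i) → i ≤ length T
TabInsertion-index newRow = z≤n
TabInsertion-index (settle _) = z≤n
TabInsertion-index (bump _ t) = s≤s (TabInsertion-index t)

TabInsertion-shape : ∀ {x T P′ i} → TabInsertion x T (P′ , i) → shape P′ ≡ addCell i (shape T)
TabInsertion-shape newRow = refl
TabInsertion-shape (settle {r} {rs = rs} ri) with RowInsertion-appended ri
... | refl = cong (_∷ shape rs) (trans (length-++ r) (+-comm (length r) 1))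
TabInsertion-shape (bump ri t) with RowInsertion-bumped ri
... | _ , u , _ , refl , refl =
  cong₂ _∷_ (trans (length-++ u) (sym (length-++ u))) (TabInsertion-shape t)

TabInsertion-↭ : ∀ {x T P′ i} → TabInsertion x T (P′ , i) → readingWord P′ ↭ x ∷ readingWord T
TabInsertion-↭ newRow = ↭-refl
TabInsertion-↭ {x} (settle {r} {rs = rs} ri) with RowInsertion-appended ri
... | refl = ↭-trans (↭-reflexive (++-assoc r [ x ] (readingWord rs))) (shift x r (readingWord rs))
TabInsertion-↭ (bump {r′ = r′} {y} {rs} ri t) =
  ↭-trans (++⁺ˡ r′ (TabInsertion-↭ t))
    (↭-trans (shift y r′ (readingWord rs)) (++⁺ʳ (readingWord rs) (RowInsertion-↭ ri)))

TabInsertion-firstRow : ∀ {x T P′ i} → TabInsertion x T (P′ , i) →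
  Σ Bump λ b → RowInsertion x (firstRow T) (firstRow P′ , b)
TabInsertion-firstRow newRow = _ , append
TabInsertion-firstRow (settle ri) = _ , ri
TabInsertion-firstRow (bump ri _) = _ , ri

TabInsertion-columnStrict : ∀ {x T P′ i} → TabInsertion x T (P′ , i) → ColumnStrict T → ColumnStrict P′
TabInsertion-columnStrict newRow _ = [] , tt
TabInsertion-columnStrict (settle ri) (below , cs) = Below-insert below ri , cs
TabInsertion-columnStrict (bump ri t) (below , cs) =
  Below-bump ri below (proj₂ (TabInsertion-firstRow t)) , TabInsertion-columnStrict t cs

TabInsertion-parity : ∀ {x T P′ i} → Unique (x ∷ readingWord T) → TabInsertion x T (P′ , i) →
  wordParity (readingWord P′) ≡ wordParity (readingWord T ∷ʳ x) ⊕ parity i ⊕ parity (cellsBelow i (shape T))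
TabInsertion-parity _ newRow = refl
TabInsertion-parity {x} uniq (settle {r} {rs = rs} ri) with RowInsertion-appended ri
... | refl = begin
  wordParity ((r ∷ʳ x) ++ W)
    ≡⟨ cong wordParity (++-assoc r [ x ] W) ⟩
  wordParity (r ++ x ∷ W)
    ≡⟨ wordParity-++ʳ r (∷↭∷ʳ x W) (wordParity-rotate W x∉W) ⟩
  wordParity (r ++ (W ∷ʳ x)) ⊕ parity (length W)
    ≡⟨ cong₂ (λ w n → wordParity w ⊕ parity n) (sym (++-assoc r W [ x ])) (length-readingWord rs) ⟩
  wordParity ((r ++ W) ∷ʳ x) ⊕ parity (sum (shape rs))
    ≡⟨ cong (_⊕ parity (sum (shape rs))) (sym (ℙ.+-identityʳ (wordParity ((r ++ W) ∷ʳ x)))) ⟩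
  wordParity ((r ++ W) ∷ʳ x) ⊕ 0ℙ ⊕ parity (sum (shape rs)) ∎
  where
  W = readingWord rs
  x∉W = Unique[x∷xs]⇒x∉xs uniq ∘ ∈-++⁺ʳ r
TabInsertion-parity {x} uniq (bump {y = y} {rs} {rs′} {i} ri t) with RowInsertion-bumped ri
... | x<y , u , v , refl , refl = begin
  wordParity ((u ++ x ∷ v) ++ readingWord rs′)
    ≡⟨ wordParity-++ʳ (u ++ x ∷ v) (↭-trans (TabInsertion-↭ t) (∷↭∷ʳ y W))
         (trans (TabInsertion-parity y-unique t) (ℙ.+-assoc (wordParity (W ∷ʳ y)) (parity i) B)) ⟩
  wordParity ((u ++ x ∷ v) ++ (W ∷ʳ y)) ⊕ (parity i ⊕ B)
    ≡⟨ cong (_⊕ (parity i ⊕ B)) (wordParity-bump u v W (<⇒≢ x<y) x∉ y∉) ⟩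
  wordParity (T ∷ʳ x) ⊕ 1ℙ ⊕ (parity i ⊕ B)
    ≡⟨ regroup (wordParity (T ∷ʳ x)) 1ℙ (parity i) B ⟩
  wordParity (T ∷ʳ x) ⊕ (1ℙ ⊕ parity i) ⊕ B
    ≡⟨ cong (λ p → wordParity (T ∷ʳ x) ⊕ p ⊕ B) (sym (ℙ.+-homo-+ 1 i)) ⟩
  wordParity (T ∷ʳ x) ⊕ parity (suc i) ⊕ B ∎
  where
  W = readingWord rs
  T = (u ++ y ∷ v) ++ W
  B = parity (cellsBelow i (shape rs))
  freshness = Unique-bump u uniq
  x∉ = proj₁ freshness
  y∉ = proj₁ (proj₂ freshness)
  y-unique = proj₂ (proj₂ freshness)
  regroup : ∀ a b c d → a ⊕ b ⊕ (c ⊕ d) ≡ a ⊕ (b ⊕ c) ⊕ d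
  regroup = RingSolver.solve-∀ parityRing

addAt-split : ∀ k i Q → ∃₂ λ u v →
  readingWord (addAt k i Q) ≡ u ++ k ∷ v × readingWord Q ≡ u ++ v × length v ≡ cellsBelow i (shape Q)
addAt-split k zero [] = [] , [] , refl , refl , refl
addAt-split k zero (r ∷ rs) =
  r , readingWord rs , ++-assoc r [ k ] (readingWord rs) , refl , length-readingWord rs
addAt-split k (suc i) [] = [] , [] , refl , refl , refl
addAt-split k (suc i) (r ∷ rs) with addAt-split k i rs
... | u , v , new , old , len =
  r ++ u , v , trans (cong (r ++_) new) (sym (++-assoc r u (k ∷ v))) ,
  trans (cong (r ++_) old) (sym (++-assoc r u v)) , len

addAt-shape : ∀ k i Q → shape (addAt k i Q) ≡ addCell i (shape Q)
addAt-shape k zero [] = refl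
addAt-shape k zero (r ∷ rs) = cong (_∷ shape rs) (trans (length-++ r) (+-comm (length r) 1))
addAt-shape k (suc i) [] = refl
addAt-shape k (suc i) (r ∷ rs) = cong (length r ∷_) (addAt-shape k i rs)

addAt-↭ : ∀ k i Q → readingWord (addAt k i Q) ↭ k ∷ readingWord Q
addAt-↭ k i Q with addAt-split k i Q
... | u , v , new , old , _ rewrite new | old = shift k u v

addAt-inversions : ∀ k i Q → All (_< k) (readingWord Q) →
  inversions (readingWord (addAt k i Q)) ≡ inversions (readingWord Q) + cellsBelow i (shape Q)
addAt-inversions k i Q Q<k with addAt-split k i Q
... | u , v , new , old , len rewrite new | old | sym len = inversions-insertMax u v Q<k

record RSInvariant (k : ℕ) (w : List ℕ) (P Q : Tableau) : Set where
  field
    columnStrict : ColumnStrict P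
    sameShape    : shape Q ≡ shape P
    recorded<    : All (_< k) (readingWord Q)
    content      : readingWord P ↭ w
    signs        : wordParity w ≡
                   parity (oddRows (shape P)) ⊕ wordParity (readingWord P) ⊕ wordParity (readingWord Q)

rs-initial : RSInvariant 1 [] [] []
rs-initial = record
  { columnStrict = tt ; sameShape = refl ; recorded< = [] ; content = ↭-refl ; signs = refl }

rs-step : ∀ {k w x P Q P′ i} → RSInvariant k w P Q → Unique (x ∷ w) → TabInsertion x P (P′ , i) →
  RSInvariant (suc k) (w ∷ʳ x) P′ (addAt k i Q)
rs-step {k} {w} {x} {P} {Q} {P′} {i} inv uniq t = record
  { columnStrict = TabInsertion-columnStrict t columnStrict
  ; sameShape    = trans (addAt-shape k i Q) (trans (cong (addCell i) sameShape) (sym (TabInsertion-shape t)))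
  ; recorded<    = All-resp-↭ (↭-sym (addAt-↭ k i Q)) (n<1+n k ∷ All.map m<n⇒m<1+n recorded<)
  ; content      = ↭-trans (TabInsertion-↭ t) (↭-trans (prep x content) (∷↭∷ʳ x w))
  ; signs        = begin
      wordParity (w ∷ʳ x)
        ≡⟨ wordParity-++ˡ [ x ] (↭-sym content) (trans signs (regroup o (wordParity W) (wordParity V))) ⟩
      wordParity (W ∷ʳ x) ⊕ (o ⊕ wordParity V)
        ≡⟨ add-twice (wordParity (W ∷ʳ x)) o (wordParity V) (parity i) B ⟩
      o ⊕ parity i ⊕ (wordParity (W ∷ʳ x) ⊕ parity i ⊕ B) ⊕ (wordParity V ⊕ B)
        ≡⟨ sym (cong₂ _⊕_ (cong₂ _⊕_ oddRows′ inserted) recorded) ⟩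
      parity (oddRows (shape P′)) ⊕ wordParity (readingWord P′) ⊕ wordParity (readingWord (addAt k i Q)) ∎
  }
  where
  open RSInvariant inv
  W = readingWord P
  V = readingWord Q
  o = parity (oddRows (shape P))
  B = parity (cellsBelow i (shape P))
  oddRows′ : parity (oddRows (shape P′)) ≡ o ⊕ parity i
  oddRows′ = trans (cong (parity ∘ oddRows) (TabInsertion-shape t))
    (oddRows-addCell i (shape P) (subst (i ≤_) (sym (length-map length P)) (TabInsertion-index t)))
  inserted : wordParity (readingWord P′) ≡ wordParity (W ∷ʳ x) ⊕ parity i ⊕ B
  inserted = TabInsertion-parity (Unique-↭ (prep x (↭-sym content)) uniq) t
  recorded : wordParity (readingWord (addAt k i Q)) ≡ wordParity V ⊕ B
  recorded = trans (cong parity (addAt-inversions k i Q recorded<))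
    (trans (ℙ.+-homo-+ (inversions V) (cellsBelow i (shape Q)))
           (cong (λ s → wordParity V ⊕ parity (cellsBelow i s)) sameShape))
  regroup : ∀ a b c → a ⊕ b ⊕ c ≡ b ⊕ (a ⊕ c)
  regroup = RingSolver.solve-∀ parityRing
  add-twice : ∀ a b c d e → a ⊕ (b ⊕ c) ≡ b ⊕ d ⊕ (a ⊕ d ⊕ e) ⊕ (c ⊕ e)
  add-twice = RingSolver.solve-∀ parityRing

rs-invariant : ∀ {k w P Q} xs → RSInvariant k w P Q → Unique (w ++ xs) →
  Σ ℕ λ k′ → RSInvariant k′ (w ++ xs) (proj₁ (rsFrom k xs (P , Q))) (proj₂ (rsFrom k xs (P , Q)))
rs-invariant {k} {w} [] inv _ = k , subst (λ w′ → RSInvariant k w′ _ _) (sym (++-identityʳ w)) inv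
rs-invariant {k} {w} {P} (x ∷ xs) inv uniq
  with insertTab x P
     | insertTab-view P (Unique-↭ (prep x (↭-sym (RSInvariant.content inv))) (Unique-∷-prefix w uniq))
... | _ | t
  with k′ , inv′ ← rs-invariant xs (rs-step inv (Unique-∷-prefix w uniq) t)
                                   (subst Unique (sym (++-assoc w [ x ] xs)) uniq) =
  k′ , subst (λ w′ → RSInvariant k′ w′ _ _) (++-assoc w [ x ] xs) inv′

length-mono-unique : ∀ {A : Set} {xs ys : List A} → Unique xs → All (_∈ ys) xs → length xs ≤ length ys
length-mono-unique [] [] = z≤n
length-mono-unique {ys = ys} (x-fresh ∷ uniq) (x∈ys ∷ xs⊆ys) =
  subst (_ ≤_) (sym (length-removeAt′ ys _))
    (s≤s (length-mono-unique uniq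
      (All.zipWith (λ (z∈ys , x≢z) → ∈-─ x∈ys z∈ys x≢z) (xs⊆ys , x-fresh))))
  where
  ∈-─ : ∀ {x z} {ys} (x∈ys : x ∈ ys) → z ∈ ys → x ≢ z → z ∈ (ys ─ x∈ys)
  ∈-─ (here refl) (here refl) x≢z = ⊥-elim (x≢z refl)
  ∈-─ (here _) (there z∈) _ = z∈
  ∈-─ (there _) (here refl) _ = here refl
  ∈-─ (there x∈) (there z∈) x≢z = there (∈-─ x∈ z∈ x≢z)

-- The cells (2k + t , j) with j below the length of row 2k + 1.  For t = 0 these are the top cells
-- of a family of disjoint dominoes; for t = 1 they are the cells in odd rows, and every domino
-- covers exactly one of them.
pairedCells : ℕ → List ℕ → List (ℕ × ℕ)
pairedCells t (_ ∷ l ∷ ls) = map (t ,_) (upTo l) ++ map (map₁ (2 +_)) (pairedCells t ls)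
pairedCells t _ = []

length-pairedCells : ∀ t ls → length (pairedCells t ls) ≡ oddRows ls
length-pairedCells t [] = refl
length-pairedCells t (_ ∷ []) = refl
length-pairedCells t (_ ∷ l ∷ ls) =
  trans (length-++ (map (t ,_) (upTo l)))
        (cong₂ _+_ (trans (length-map _ (upTo l)) (length-upTo l))
                   (trans (length-map _ (pairedCells t ls)) (length-pairedCells t ls)))

pairedCells-dominoFamily : ∀ ls → Linked _≥_ ls → DominoFamily ls (pairedCells 0 ls)
pairedCells-dominoFamily [] _ = [] , []
pairedCells-dominoFamily (_ ∷ []) _ = [] , []
pairedCells-dominoFamily (_ ∷ l ∷ ls) (l≤ ∷ decreasing)
  with fits , disjoint ← pairedCells-dominoFamily ls (Linked.tail decreasing) =
  All.++⁺ (All.map⁺ (All.applyUpTo⁺₁ _ l (λ j<l → <-≤-trans j<l l≤ , j<l))) (All.map⁺ fits) ,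
  AllPairs.++⁺ (AllPairs.map⁺ (AllPairs.map (λ j≢j′ same → j≢j′ (proj₁ same)) (Unique.upTo⁺ l)))
               (AllPairs.map⁺ (AllPairs.map shifted disjoint))
               (All.map⁺ (All.applyUpTo⁺₂ _ l (λ _ → All.map⁺ (All.universal (λ _ → topRow) _))))
  where
  shifted : ∀ {d e} → ¬ Overlap d e → ¬ Overlap (map₁ (2 +_) d) (map₁ (2 +_) e)
  shifted ¬overlap (j≡ , rows≡) = ¬overlap (j≡ , ⊎-map unshift (⊎-map unshift unshift) rows≡)
    where
    unshift : ∀ {m n} → 2 + m ≡ 2 + n → m ≡ n
    unshift = suc-injective ∘ suc-injective
  topRow : ∀ {j d} → ¬ Overlap (0 , j) (map₁ (2 +_) d)
  topRow (_ , inj₁ ())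
  topRow (_ , inj₂ (inj₁ ()))
  topRow (_ , inj₂ (inj₂ ()))

oddRow : Parity → ℕ → ℕ
oddRow 0ℙ i = suc i
oddRow 1ℙ i = i

oddRowCell : ℕ × ℕ → ℕ × ℕ
oddRowCell (i , j) = oddRow (parity i) i , j

∈-pairedCells : ∀ ls i {j} → parity i ≡ 1ℙ → j < rowLen ls i → (i , j) ∈ pairedCells 1 ls
∈-pairedCells (_ ∷ []) (suc zero) _ ()
∈-pairedCells (_ ∷ []) (suc (suc i)) _ ()
∈-pairedCells (_ ∷ l ∷ ls) (suc zero) _ j<l = ∈-++⁺ˡ (∈-map⁺ (1 ,_) (∈-upTo⁺ j<l))
∈-pairedCells (_ ∷ l ∷ ls) (suc (suc i)) odd j< =
  ∈-++⁺ʳ (map (1 ,_) (upTo l)) (∈-map⁺ (map₁ (2 +_)) (∈-pairedCells ls i odd j<))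

oddRowCell-∈ : ∀ {ls} d → FitsDomino ls d → oddRowCell d ∈ pairedCells 1 ls
oddRowCell-∈ {ls} (i , j) (top , bottom) with parity i in eq
... | 1ℙ = ∈-pairedCells ls i eq top
... | 0ℙ = ∈-pairedCells ls (suc i) (trans (ℙ.+-homo-+ 1 i) (cong (1ℙ ⊕_) eq)) bottom

oddRowCell-overlap : ∀ d e → oddRowCell d ≡ oddRowCell e → Overlap d e
oddRowCell-overlap (i , j) (i′ , j′) eq with parity i | parity i′
... | 1ℙ | 1ℙ = cong proj₂ eq , inj₁ (cong proj₁ eq)
... | 1ℙ | 0ℙ = cong proj₂ eq , inj₂ (inj₂ (cong proj₁ eq))
... | 0ℙ | 1ℙ = cong proj₂ eq , inj₂ (inj₁ (cong proj₁ eq))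
... | 0ℙ | 0ℙ = cong proj₂ eq , inj₁ (suc-injective (cong proj₁ eq))

dominoFamily-length≤ : ∀ {ls ds} → DominoFamily ls ds → length ds ≤ oddRows ls
dominoFamily-length≤ {ls} {ds} (fits , disjoint) =
  subst₂ _≤_ (length-map oddRowCell ds) (length-pairedCells 1 ls)
    (length-mono-unique
      (AllPairs.map⁺ (AllPairs.map (λ {d} {e} ¬overlap → ¬overlap ∘ oddRowCell-overlap d e) disjoint))
      (All.map⁺ (All.map (λ {d} → oddRowCell-∈ {ls} d) fits)))

IsV⇒≡oddRows : ∀ {ls v} → Linked _≥_ ls → IsV ls v → v ≡ oddRows ls
IsV⇒≡oddRows {ls} decreasing ((ds , family , refl) , maximal) =
  ≤-antisym (dominoFamily-length≤ {ls} family)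
            (subst (_≤ length ds) (length-pairedCells 0 ls) (maximal _ (pairedCells-dominoFamily ls decreasing)))


proposition5p3 : (n : ℕ) (π : List ℕ) → π ↭ map suc (upTo n) →
    (v : ℕ) → IsV (shape (proj₁ (RS π))) v →
    sgn π ≡ (-1ℤ ^ v) * sgn (readingWord (proj₁ (RS π))) * sgn (readingWord (proj₂ (RS π)))
proposition5p3 n π π↭ v isV
  with k , inv ← rs-invariant π rs-initial
                   (Unique-↭ (↭-sym π↭) (Unique.map⁺ suc-injective (Unique.upTo⁺ n)))
  rewrite IsV⇒≡oddRows (columnStrict⇒shape-decreasing _ (RSInvariant.columnStrict inv)) isV = begin
  -1ℤ ^ inversions π
    ≡⟨ -1^≡paritySign (inversions π) ⟩
  paritySign (wordParity π)
    ≡⟨ cong paritySign (RSInvariant.signs inv) ⟩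
  paritySign (parity o ⊕ wordParity P ⊕ wordParity Q)
    ≡⟨ trans (paritySign-⊕ (parity o ⊕ wordParity P) (wordParity Q))
             (cong (_* paritySign (wordParity Q)) (paritySign-⊕ (parity o) (wordParity P))) ⟩
  paritySign (parity o) * paritySign (wordParity P) * paritySign (wordParity Q)
    ≡⟨ sym (cong₂ _*_ (cong₂ _*_ (-1^≡paritySign o) (-1^≡paritySign (inversions P)))
                      (-1^≡paritySign (inversions Q))) ⟩
  -1ℤ ^ o * sgn P * sgn Q ∎
  where
  P = readingWord (proj₁ (RS π))
  Q = readingWord (proj₂ (RS π))
  o = oddRows (shape (proj₁ (RS π)))
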